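{- Let $G$ be a finite simple graph. If $L_G$ has no induced $\overline{K}_3$ (no three pairwise non-adjacent vertices) and no $K_4$ subgraph, then $L_G=L(G)$.
   Context: A biclique of $G$ is a vertex set $B\subseteq V(G)$ such that $G[B]$ is a complete bipartite graph and $B$ is inclusion-wise maximal with this property. The biclique line graph $L_G$ has vertex set $E(G)$, two edges of $G$ being adjacent iff they are both edges of $G[B]$ for some biclique $B$ of $G$. $L(G)$ is the ordinary line graph of $G$ (vertex set $E(G)$, two edges adjacent iff they share an endpoint). -}

module Defs where

open import Data.Nat using (ℕ)
open import Data.Fin using (Fin; _<_)
open import Data.Bool using (Bool; true; false)
open import Data.Product using (Σ; _×_; _,_; ∃; proj₁; proj₂)
open import Relation.Nullary using (¬_)
open import Relation.Binary.PropositionalEquality using (_≡_; _≢_)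
open import Function.Bundles using (_⇔_)

record Graph (n : ℕ) : Set where
  field
    adj   : Fin n → Fin n → Bool
    sym   : ∀ u v → adj u v ≡ adj v u
    irrefl : ∀ u → adj u u ≡ false
open Graph public

VSet : ℕ → Set
VSet n = Fin n → Bool

_⊆ᵥ_ : ∀ {n} → VSet n → VSet n → Set
B ⊆ᵥ B' = ∀ u → B u ≡ true → B' u ≡ true

-- G[B] is a complete bipartite graph: there is a 2-colouring of B such that
-- two vertices of B are adjacent iff they get different colours.
-- (Parts may be empty; this does not affect bicliques containing an edge,
-- which are the only ones relevant for L_G.)
IsCompleteBipartite : ∀ {n} → Graph n → VSet n → Set
IsCompleteBipartite G B =
  Σ (Fin _ → Bool) λ c → ∀ u v → B u ≡ true → B v ≡ true →
    ((adj G u v ≡ true) ⇔ (c u ≢ c v))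

IsBiclique : ∀ {n} → Graph n → VSet n → Set
IsBiclique G B = IsCompleteBipartite G B ×
  (∀ B' → B ⊆ᵥ B' → IsCompleteBipartite G B' → B' ⊆ᵥ B)

Edge : ∀ {n} → Graph n → Set
Edge {n} G = Σ (Fin n × Fin n) λ p → (proj₁ p < proj₂ p) × (adj G (proj₁ p) (proj₂ p) ≡ true)

fst : ∀ {n} (G : Graph n) → Edge G → Fin n
fst G e = proj₁ (proj₁ e)

snd : ∀ {n} (G : Graph n) → Edge G → Fin n
snd G e = proj₂ (proj₁ e)

SameEdge : ∀ {n} (G : Graph n) → Edge G → Edge G → Set
SameEdge G e f = (fst G e ≡ fst G f) × (snd G e ≡ snd G f)

EdgeIn : ∀ {n} (G : Graph n) → VSet n → Edge G → Set
EdgeIn G B e = (B (fst G e) ≡ true) × (B (snd G e) ≡ true)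

AdjLG : ∀ {n} (G : Graph n) → Edge G → Edge G → Set
AdjLG G e f = ¬ SameEdge G e f ×
  Σ (VSet _) λ B → IsBiclique G B × EdgeIn G B e × EdgeIn G B f

AdjL : ∀ {n} (G : Graph n) → Edge G → Edge G → Set
AdjL G e f = ¬ SameEdge G e f ×
  ((fst G e ≡ fst G f) Data.Sum.⊎ (fst G e ≡ snd G f) Data.Sum.⊎
   (snd G e ≡ fst G f) Data.Sum.⊎ (snd G e ≡ snd G f))
  where import Data.Sum

HasIndependentTriple : ∀ {n} (G : Graph n) → Set
HasIndependentTriple G = Σ (Edge G) λ a → Σ (Edge G) λ b → Σ (Edge G) λ c →
  ¬ SameEdge G a b × ¬ SameEdge G a c × ¬ SameEdge G b c ×
  ¬ AdjLG G a b × ¬ AdjLG G a c × ¬ AdjLG G b c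

HasK4 : ∀ {n} (G : Graph n) → Set
HasK4 G = Σ (Edge G) λ a → Σ (Edge G) λ b → Σ (Edge G) λ c → Σ (Edge G) λ d →
  AdjLG G a b × AdjLG G a c × AdjLG G a d ×
  AdjLG G b c × AdjLG G b d × AdjLG G c d

-- If L_G has no independent triple, G is triangle-free, since no complete
-- bipartite set contains a triangle, so the three edges of a triangle share no
-- biclique. In a triangle-free graph the edges at a vertex u all lie in the
-- biclique N(u) ∪ {z | N(u) ⊆ N(z)}, coloured by adjacency to u; hence
-- L(G) ⊆ L_G. Conversely, two disjoint edges ab, cd of a biclique B close,
-- through the bipartition of B, into a 4-cycle inside B, and the four edges of
-- that cycle are pairwise adjacent in L_G: a K₄. So without K₄, L_G ⊆ L(G).
module Submission where

open import Defs
open import Data.Nat using (ℕ)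
open import Data.Fin using (Fin)
open import Data.Fin.Properties using (<-cmp; _≟_; all?)
open import Data.Bool using (Bool; true; false; _∨_)
open import Data.Bool.Properties using (∨-zeroʳ; ¬-not) renaming (_≟_ to _≟ᵇ_)
open import Data.Product using (Σ; _×_; _,_; proj₁; proj₂)
open import Data.Sum using (_⊎_; inj₁; inj₂)
open import Data.Empty using (⊥; ⊥-elim)
open import Relation.Nullary using (¬_; Dec; yes; no; does; contradiction)
open import Relation.Nullary.Decidable using (_→-dec_; dec-true; dec-false; decidable-stable)
open import Relation.Binary using (tri<; tri≈; tri>)
open import Relation.Binary.PropositionalEquality
  using (_≡_; _≢_; refl; trans; cong; cong₂; ≢-sym) renaming (sym to ≡-sym)
open import Function.Bundles using (_⇔_; mk⇔; Equivalence)
open Equivalence using (to; from)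

both-≢⇒≡ : ∀ {x y z : Bool} → x ≢ z → y ≢ z → x ≡ y
both-≢⇒≡ x≢z y≢z = trans (¬-not x≢z) (≡-sym (¬-not y≢z))

module _ {n : ℕ} (G : Graph n) where

  private
    variable
      a b c d p q r s u v z : Fin n
      B : VSet n
      x y : Edge G

  adj⇒≢ : adj G a b ≡ true → a ≢ b
  adj⇒≢ {a} ab refl = contradiction (trans (≡-sym ab) (irrefl G a)) λ ()

  adj-sym : adj G a b ≡ true → adj G b a ≡ true
  adj-sym {a} {b} ab = trans (sym G b a) ab

  edge-adj : (e : Edge G) → adj G (fst G e) (snd G e) ≡ true
  edge-adj e = proj₂ (proj₂ e)

  data Joins (e : Edge G) (p q : Fin n) : Set where
    forwards  : fst G e ≡ p → snd G e ≡ q → Joins e p q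
    backwards : fst G e ≡ q → snd G e ≡ p → Joins e p q

  Joins-sym : Joins x p q → Joins x q p
  Joins-sym (forwards eq₁ eq₂)  = backwards eq₁ eq₂
  Joins-sym (backwards eq₁ eq₂) = forwards eq₁ eq₂

  edgeJoining : adj G p q ≡ true → Σ (Edge G) λ e → Joins e p q
  edgeJoining {p} {q} pq with <-cmp p q
  ... | tri< p<q _ _ = ((p , q) , p<q , pq) , forwards refl refl
  ... | tri≈ _ p≡q _ = ⊥-elim (adj⇒≢ pq p≡q)
  ... | tri> _ _ q<p = ((q , p) , q<p , adj-sym pq) , backwards refl refl

  joins-edgeIn : Joins x p q → B p ≡ true → B q ≡ true → EdgeIn G B x
  joins-edgeIn (forwards refl refl)  p∈B q∈B = p∈B , q∈B
  joins-edgeIn (backwards refl refl) p∈B q∈B = q∈B , p∈B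

  edgeIn-joins : Joins x p q → EdgeIn G B x → B p ≡ true × B q ≡ true
  edgeIn-joins (forwards refl refl)  (p∈B , q∈B) = p∈B , q∈B
  edgeIn-joins (backwards refl refl) (q∈B , p∈B) = p∈B , q∈B

  joins-≢ : Joins x p q → Joins y r s → p ≢ r → p ≢ s → ¬ SameEdge G x y
  joins-≢ (forwards refl refl)  (forwards refl refl)  p≢r _   (eq , _) = p≢r eq
  joins-≢ (forwards refl refl)  (backwards refl refl) _   p≢s (eq , _) = p≢s eq
  joins-≢ (backwards refl refl) (forwards refl refl)  _   p≢s (_ , eq) = p≢s eq
  joins-≢ (backwards refl refl) (backwards refl refl) p≢r _   (_ , eq) = p≢r eq

  completeBipartite-triangleFree : IsCompleteBipartite G B →
    B a ≡ true → B b ≡ true → B c ≡ true →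
    adj G a b ≡ true → adj G b c ≡ true → adj G a c ≡ true → ⊥
  completeBipartite-triangleFree {a = a} {b} {c} (col , h) a∈B b∈B c∈B ab bc ac =
    to (h a c a∈B c∈B) ac
      (both-≢⇒≡ (to (h a b a∈B b∈B) ab) (≢-sym (to (h b c b∈B c∈B) bc)))

  completeBipartite-crossEdges : IsCompleteBipartite G B →
    B a ≡ true → B b ≡ true → B c ≡ true → B d ≡ true →
    adj G a b ≡ true → adj G c d ≡ true →
    (adj G a d ≡ true × adj G c b ≡ true) ⊎ (adj G a c ≡ true × adj G d b ≡ true)
  completeBipartite-crossEdges {a = a} {b} {c} {d} (col , h) a∈B b∈B c∈B d∈B ab cd
    with col a ≟ᵇ col c
  ... | yes a~c = inj₁
    ( from (h a d a∈B d∈B) (λ a~d → c≁d (trans (≡-sym a~c) a~d))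
    , from (h c b c∈B b∈B) (λ c~b → a≁b (trans a~c c~b)) )
    where
    a≁b = to (h a b a∈B b∈B) ab
    c≁d = to (h c d c∈B d∈B) cd
  ... | no a≁c = inj₂
    ( from (h a c a∈B c∈B) a≁c
    , from (h d b d∈B b∈B) (λ d~b → a≁b (trans (both-≢⇒≡ a≁c (≢-sym c≁d)) d~b)) )
    where
    a≁b = to (h a b a∈B b∈B) ab
    c≁d = to (h c d c∈B d∈B) cd

  TriangleFree : Set
  TriangleFree = ∀ {a b c} → adj G a b ≡ true → adj G b c ≡ true → adj G a c ≡ true → ⊥

  triangleEdges-¬adjLG : adj G p q ≡ true → adj G q r ≡ true → adj G p r ≡ true →
    Joins x p q → Joins y q r → ¬ AdjLG G x y
  triangleEdges-¬adjLG pq qr pr Jx Jy (_ , B , (cb , _) , x∈B , y∈B)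
    with edgeIn-joins {B = B} Jx x∈B | edgeIn-joins {B = B} Jy y∈B
  ... | p∈B , q∈B | _ , r∈B = completeBipartite-triangleFree cb p∈B q∈B r∈B pq qr pr

  noIndependentTriple⇒triangleFree : ¬ HasIndependentTriple G → TriangleFree
  noIndependentTriple⇒triangleFree noTriple {a} {b} {c} ab bc ac
    with edgeJoining ab | edgeJoining bc | edgeJoining ac
  ... | eab , Jab | ebc , Jbc | eac , Jac = noTriple
    ( eab , ebc , eac
    , joins-≢ Jab Jbc a≢b a≢c
    , joins-≢ (Joins-sym Jab) Jac (≢-sym a≢b) b≢c
    , joins-≢ Jbc Jac (≢-sym a≢b) b≢c
    , triangleEdges-¬adjLG ab bc ac Jab Jbc
    , triangleEdges-¬adjLG (adj-sym ab) ac bc (Joins-sym Jab) Jac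
    , triangleEdges-¬adjLG bc (adj-sym ac) (adj-sym ab) Jbc (Joins-sym Jac) )
    where
    a≢b = adj⇒≢ ab
    a≢c = adj⇒≢ ac
    b≢c = adj⇒≢ bc

  Dominates : Fin n → Fin n → Set
  Dominates u z = ∀ y → adj G u y ≡ true → adj G z y ≡ true

  dominates? : ∀ u z → Dec (Dominates u z)
  dominates? u z = all? λ y → (adj G u y ≟ᵇ true) →-dec (adj G z y ≟ᵇ true)

  -- For triangle-free G and non-isolated u, the biclique containing every edge at u.
  -- Opaque, so that a `with` on adj G u z cannot rewrite inside membership proofs.
  opaque
    star : Fin n → VSet n
    star u z = adj G u z ∨ does (dominates? u z)

    adj⇒∈star : adj G u z ≡ true → star u z ≡ true
    adj⇒∈star uz rewrite uz = refl

    dominates⇒∈star : Dominates u z → star u z ≡ true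
    dominates⇒∈star {u} {z} dom =
      trans (cong (adj G u z ∨_) (dec-true (dominates? u z) dom)) (∨-zeroʳ (adj G u z))

    ∈star⇒dominates : star u z ≡ true → adj G u z ≡ false → Dominates u z
    ∈star⇒dominates {u} {z} z∈star uz = decidable-stable (dominates? u z) λ ¬dom →
      contradiction (trans (≡-sym (cong₂ _∨_ uz (dec-false (dominates? u z) ¬dom))) z∈star) λ ()

  centre∈star : star u u ≡ true
  centre∈star = dominates⇒∈star λ _ uy → uy

  star-isCompleteBipartite : TriangleFree → adj G u v ≡ true → IsCompleteBipartite G (star u)
  star-isCompleteBipartite {u} {v} triangleFree uv = adj G u , colouring
    where
    colouring : ∀ x y → star u x ≡ true → star u y ≡ true →
      (adj G x y ≡ true) ⇔ (adj G u x ≢ adj G u y)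
    colouring x y x∈ y∈ with adj G u x in ux | adj G u y in uy
    ... | true  | true  = mk⇔ (λ xy → ⊥-elim (triangleFree (adj-sym ux) uy xy)) (λ ne → ⊥-elim (ne refl))
    ... | true  | false = mk⇔ (λ _ ()) (λ _ → adj-sym (∈star⇒dominates y∈ uy x ux))
    ... | false | true  = mk⇔ (λ _ ()) (λ _ → ∈star⇒dominates x∈ ux y uy)
    ... | false | false = mk⇔
      (λ xy → ⊥-elim (triangleFree xy (∈star⇒dominates y∈ uy v uv) (∈star⇒dominates x∈ ux v uv)))
      (λ ne → ⊥-elim (ne refl))

  star-maximal : ∀ u B′ → star u ⊆ᵥ B′ → IsCompleteBipartite G B′ → B′ ⊆ᵥ star u
  star-maximal u B′ star⊆B′ (col , h) z z∈B′ with adj G u z in uz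
  ... | true  = adj⇒∈star uz
  ... | false = dominates⇒∈star λ y uy →
    let y∈B′ = star⊆B′ y (adj⇒∈star uy)
    in from (h z y z∈B′ y∈B′) (λ z~y → to (h u y u∈B′ y∈B′) uy (trans (≡-sym z~u) z~y))
    where
    u∈B′ = star⊆B′ u centre∈star
    z~u : col z ≡ col u
    z~u with col z ≟ᵇ col u
    ... | yes z~u = z~u
    ... | no z≁u = contradiction (trans (≡-sym (adj-sym (from (h z u z∈B′ u∈B′) z≁u))) uz) λ ()

  star-isBiclique : TriangleFree → adj G u v ≡ true → IsBiclique G (star u)
  star-isBiclique {u} triangleFree uv = star-isCompleteBipartite triangleFree uv , star-maximal u

  data Incident (e : Edge G) (u : Fin n) : Set where
    at-fst : fst G e ≡ u → Incident e u
    at-snd : snd G e ≡ u → Incident e u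

  incident⇒edgeIn-star : Incident x u → EdgeIn G (star u) x
  incident⇒edgeIn-star {x} (at-fst refl) = centre∈star , adj⇒∈star (edge-adj x)
  incident⇒edgeIn-star {x} (at-snd refl) = adj⇒∈star (adj-sym (edge-adj x)) , centre∈star

  incident⇒neighbour : Incident x u → Σ (Fin n) λ v → adj G u v ≡ true
  incident⇒neighbour {x} (at-fst refl) = snd G x , edge-adj x
  incident⇒neighbour {x} (at-snd refl) = fst G x , adj-sym (edge-adj x)

  adjL⇒commonEndpoint : ∀ x y → AdjL G x y → Σ (Fin n) λ u → Incident x u × Incident y u
  adjL⇒commonEndpoint x y (_ , inj₁ eq)               = fst G x , at-fst refl , at-fst (≡-sym eq)
  adjL⇒commonEndpoint x y (_ , inj₂ (inj₁ eq))        = fst G x , at-fst refl , at-snd (≡-sym eq)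
  adjL⇒commonEndpoint x y (_ , inj₂ (inj₂ (inj₁ eq))) = snd G x , at-snd refl , at-fst (≡-sym eq)
  adjL⇒commonEndpoint x y (_ , inj₂ (inj₂ (inj₂ eq))) = snd G x , at-snd refl , at-snd (≡-sym eq)

  adjL⇒adjLG : TriangleFree → ∀ x y → AdjL G x y → AdjLG G x y
  adjL⇒adjLG triangleFree x y adjL with adjL⇒commonEndpoint x y adjL
  ... | u , xu , yu =
    proj₁ adjL , star u , star-isBiclique triangleFree (proj₂ (incident⇒neighbour xu)) ,
    incident⇒edgeIn-star xu , incident⇒edgeIn-star yu

  biclique-fourCycle⇒K4 : IsBiclique G B →
    B a ≡ true → B b ≡ true → B c ≡ true → B d ≡ true →
    adj G a b ≡ true → adj G b c ≡ true → adj G c d ≡ true → adj G d a ≡ true →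
    a ≢ c → b ≢ d → HasK4 G
  biclique-fourCycle⇒K4 {B = B} bic a∈B b∈B c∈B d∈B ab bc cd da a≢c b≢d
    with edgeJoining ab | edgeJoining bc | edgeJoining cd | edgeJoining da
  ... | eab , Jab | ebc , Jbc | ecd , Jcd | eda , Jda =
    eab , ebc , ecd , eda ,
    adjacent eab ebc ab∈B bc∈B (joins-≢ Jab Jbc (adj⇒≢ ab) a≢c) ,
    adjacent eab ecd ab∈B cd∈B (joins-≢ Jab Jcd a≢c (≢-sym (adj⇒≢ da))) ,
    adjacent eab eda ab∈B da∈B (joins-≢ (Joins-sym Jab) Jda b≢d (≢-sym (adj⇒≢ ab))) ,
    adjacent ebc ecd bc∈B cd∈B (joins-≢ Jbc Jcd (adj⇒≢ bc) b≢d) ,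
    adjacent ebc eda bc∈B da∈B (joins-≢ Jbc Jda b≢d (≢-sym (adj⇒≢ ab))) ,
    adjacent ecd eda cd∈B da∈B (joins-≢ Jcd Jda (adj⇒≢ cd) (≢-sym a≢c))
    where
    ab∈B = joins-edgeIn Jab a∈B b∈B
    bc∈B = joins-edgeIn Jbc b∈B c∈B
    cd∈B = joins-edgeIn Jcd c∈B d∈B
    da∈B = joins-edgeIn Jda d∈B a∈B
    adjacent : ∀ x y → EdgeIn G B x → EdgeIn G B y → ¬ SameEdge G x y → AdjLG G x y
    adjacent _ _ x∈B y∈B x≠y = x≠y , B , bic , x∈B , y∈B

  biclique-disjointEdges⇒K4 : IsBiclique G B → EdgeIn G B x → EdgeIn G B y →
    fst G x ≢ fst G y → fst G x ≢ snd G y → snd G x ≢ fst G y → snd G x ≢ snd G y →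
    HasK4 G
  biclique-disjointEdges⇒K4 {x = x} {y} bic (a∈B , b∈B) (c∈B , d∈B) a≢c a≢d b≢c b≢d
    with completeBipartite-crossEdges (proj₁ bic) a∈B b∈B c∈B d∈B (edge-adj x) (edge-adj y)
  ... | inj₁ (ad , cb) =
    biclique-fourCycle⇒K4 bic a∈B b∈B c∈B d∈B (edge-adj x) (adj-sym cb) (edge-adj y) (adj-sym ad) a≢c b≢d
  ... | inj₂ (ac , db) =
    biclique-fourCycle⇒K4 bic a∈B b∈B d∈B c∈B (edge-adj x) (adj-sym db) (adj-sym (edge-adj y)) (adj-sym ac) a≢d b≢c

  adjLG⇒adjL : ¬ HasK4 G → ∀ x y → AdjLG G x y → AdjL G x y
  adjLG⇒adjL noK4 x y (x≠y , B , bic , x∈B , y∈B)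
    with fst G x ≟ fst G y | fst G x ≟ snd G y | snd G x ≟ fst G y | snd G x ≟ snd G y
  ... | yes eq | _      | _      | _      = x≠y , inj₁ eq
  ... | no _   | yes eq | _      | _      = x≠y , inj₂ (inj₁ eq)
  ... | no _   | no _   | yes eq | _      = x≠y , inj₂ (inj₂ (inj₁ eq))
  ... | no _   | no _   | no _   | yes eq = x≠y , inj₂ (inj₂ (inj₂ eq))
  ... | no a≢c | no a≢d | no b≢c | no b≢d =
    ⊥-elim (noK4 (biclique-disjointEdges⇒K4 {B = B} {x = x} {y = y} bic x∈B y∈B a≢c a≢d b≢c b≢d))

lemma14 : ∀ {n} (G : Graph n) → ¬ HasIndependentTriple G → ¬ HasK4 G →
    ∀ (e f : Edge G) → AdjLG G e f ⇔ AdjL G e f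
lemma14 G noTriple noK4 e f =
  mk⇔ (adjLG⇒adjL G noK4 e f)
      (adjL⇒adjLG G (noIndependentTriple⇒triangleFree G noTriple) e f)
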